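{- Let $T$ be a tree on $n\ge 2$ vertices and let $t=2^{\lfloor\log\log n\rfloor+2}$. Construct subtrees $S_0\subseteq S_1\subseteq\cdots$ of $T$ as follows: $S_0$ is empty; for $i=1,\dots,t$, if $S_{i-1}=T$ stop and set $S=S_{i-1}$; otherwise let $x_i$ be a centroid of a connected component of maximum size of $T-V(S_{i-1})$, and let $S_i$ be the smallest subtree of $T$ containing $x_i$ and all vertices of $S_{i-1}$. If all $t$ iterations are performed, set $S=S_t$. Then every connected component $H$ of $T-V(S)$ satisfies $|V(H)|\le n/\log n$.
   Context: Logarithms are base 2. A centroid of a tree $H$ is a vertex $v$ of $H$ such that every connected component of $H-v$ has at most $|V(H)|/2$ vertices. Ties in the choice of maximum-size component and of centroid are broken arbitrarily. -}

module Defs where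

open import Data.Nat using (ℕ; zero; suc; _+_; _*_; _^_; _≤_)
open import Data.Nat.Logarithm using (⌊log₂_⌋)
open import Data.Fin using (Fin)
open import Data.Fin.Subset using (Subset; _∈_; _∉_; _⊆_; ∁; _∪_; _-_; ∣_∣; ⁅_⁆; ⊤; ⊥)
open import Data.Product using (Σ; ∃; _×_)
open import Data.List using (List; []; _∷_; length)
open import Data.List.Relation.Unary.Unique.Propositional using (Unique)
open import Relation.Nullary using (¬_)
open import Relation.Binary.PropositionalEquality using (_≡_)

record Graph (n : ℕ) : Set₁ where
  field
    Adj   : Fin n → Fin n → Set
    sym   : ∀ {x y} → Adj x y → Adj y x
    irrefl : ∀ {x} → ¬ Adj x x
open Graph public

module _ {n : ℕ} (G : Graph n) where

  data WalkIn (U : Subset n) : Fin n → Fin n → Set where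
    here : ∀ {x} → x ∈ U → WalkIn U x x
    step : ∀ {x y z} → x ∈ U → Adj G x y → WalkIn U y z → WalkIn U x z

  ConnectedIn : Subset n → Set
  ConnectedIn U = ∀ x y → x ∈ U → y ∈ U → WalkIn U x y

  -- A cycle: distinct vertices x , v₁ , … , vₖ (k ≥ 2) with consecutive ones
  -- adjacent and vₖ adjacent to x; encoded as a first vertex, an edge to a
  -- second vertex y, and a path from y back to a vertex adjacent to x.
  data Path : Fin n → Fin n → List (Fin n) → Set where
    end  : ∀ {x} → Path x x (x ∷ [])
    cons : ∀ {x y z vs} → Adj G x y → Path y z vs → Path x z (x ∷ vs)

  HasCycle : Set
  HasCycle = Σ (List (Fin n)) λ vs → Σ (Fin n) λ x → Σ (Fin n) λ z →
               Path x z vs × Unique vs × 3 ≤ length vs × Adj G z x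

  IsTree : Set
  IsTree = ConnectedIn ⊤ × ¬ HasCycle

  IsComponent : Subset n → Subset n → Set
  IsComponent U C =
    (∃ λ x → x ∈ C) × C ⊆ U × ConnectedIn C ×
    (∀ x y → x ∈ C → y ∈ U → Adj G x y → y ∈ C)

  IsMaxComponent : Subset n → Subset n → Set
  IsMaxComponent U C = IsComponent U C × (∀ D → IsComponent U D → ∣ D ∣ ≤ ∣ C ∣)

  IsCentroid : Subset n → Fin n → Set
  IsCentroid C v = v ∈ C × (∀ D → IsComponent (C - v) D → 2 * ∣ D ∣ ≤ ∣ C ∣)

  IsSmallestSubtree : Subset n → Subset n → Set
  IsSmallestSubtree A B =
    A ⊆ B × ConnectedIn B × (∀ B' → A ⊆ B' → ConnectedIn B' → B ⊆ B')

  Step : Subset n → Subset n → Set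
  Step S S' = Σ (Subset n) λ C → Σ (Fin n) λ x →
    IsMaxComponent (∁ S) C × IsCentroid C x × IsSmallestSubtree (⁅ x ⁆ ∪ S) S'

  -- Process k S R : starting from the current subtree S with k iterations
  -- still allowed, the procedure (with some choice of ties) ends with R.
  data Process : ℕ → Subset n → Subset n → Set where
    stop-full  : ∀ {k} → Process k ⊤ ⊤
    stop-limit : ∀ {S} → Process zero S S
    next       : ∀ {k S S' R} → Step S S' → Process k S' R → Process (suc k) S R

-- t = 2 ^ (⌊log log n⌋ + 2); for n ≥ 2, ⌊log₂ (log₂ n)⌋ = ⌊log₂ ⌊log₂ n⌋⌋.
iterations : ℕ → ℕ
iterations n = 2 ^ (⌊log₂ ⌊log₂ n ⌋ ⌋ + 2)

-- Let H be a component of T − S and h = |H|. The components C₁, …, C_t chosen by the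
-- procedure, followed by H, all have at least h vertices, and a later set in this list either
-- misses an earlier Cᵢ or, since it avoids the centroid xᵢ ∈ S, lies in a component of
-- Cᵢ − xᵢ and so has at most |Cᵢ|/2 vertices. Hence sets whose sizes lie in the same dyadic
-- band [2ʲh, 2ʲ⁺¹h) are pairwise disjoint, there are at most n/(2ʲh) of them, and summing
-- over the bands gives (t + 1)·h < 2n. As t > 2 log n, this is h log n < n, i.e. n^h ≤ 2^n.
--
-- Components are only obtained under a double negation (reachability in a graph with
-- undecidable adjacency is not decidable); this is harmless because the conclusion is a
-- decidable inequality.
module Submission where

open import Defs renaming (sym to Adj-sym)
open import Data.Nat using (ℕ; zero; suc; _+_; _*_; _^_; _≤_; _<_; _≤?_; z≤n; s≤s; >-nonZero)
open import Data.Nat.Properties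
open import Algebra.Properties.CommutativeSemigroup *-commutativeSemigroup using (x∙yz≈y∙xz)
open import Data.Nat.Logarithm using (⌊log₂_⌋; ⌊log₂⌋-mono-≤; ⌊log₂[2^n]⌋≡n)
open import Data.Fin as Fin using (Fin)
open import Data.Fin.Properties using (sequence)
open import Data.Fin.Subset
  using (Subset; inside; outside; _∈_; _∉_; _⊆_; ∁; _∪_; _∩_; _-_; ⁅_⁆; ∣_∣; ⋃; ⊥; Nonempty; Empty)
open import Data.Fin.Subset.Properties
  using (drop-∷-Empty; ∉⊥; x∈p∩q⁺; x∈p∩q⁻; x∈p∪q⁻; p⊆p∪q; q⊆p∪q; x∈⁅x⁆; ∣⁅x⁆∣≡1; x∈⁅y⁆⇒x≡y;
         ∣p∣≤n; p⊆q⇒∣p∣≤∣q∣; p⊆q⇒∁p⊇∁q; x∈∁p⇒x∉p; ∈⊤; x∈p∧x≢y⇒x∈p-y)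
open import Data.Vec using ([]; _∷_; here; tabulate)
open import Data.Vec.Properties using (lookup∘tabulate; lookup⇒[]=; []=⇒lookup)
open import Data.List using (List; []; _∷_; length; filter)
open import Data.List.Relation.Unary.All as All using (All; []; _∷_)
import Data.List.Relation.Unary.All.Properties as All
open import Data.List.Relation.Unary.AllPairs using (AllPairs; []; _∷_)
import Data.List.Relation.Unary.AllPairs.Properties as AllPairs
open import Data.Product using (Σ; _×_; _,_; proj₁; proj₂)
open import Data.Sum using (_⊎_; inj₁; inj₂)
open import Effect.Monad using (RawMonad)
open import Function using (_∘_; id)
open import Level using (0ℓ)
open import Relation.Binary.PropositionalEquality
  using (_≡_; refl; sym; trans; cong; subst)
open import Relation.Nullary using (¬_; Dec; yes; no; does; proof; contradiction)
open import Relation.Nullary.Reflects using (Reflects; invert)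
open import Relation.Nullary.Decidable using (dec-true; decidable-stable; ¬¬-excluded-middle)
open import Relation.Nullary.Negation using (¬¬-Monad; ¬¬-map)
open import Relation.Unary using (Pred; Decidable)
open import Relation.Unary.Properties using (∁?)

open RawMonad (¬¬-Monad {0ℓ})

private
  variable
    n : ℕ

Disjoint : Subset n → Subset n → Set
Disjoint p q = Empty (p ∩ q)

∣p∪q∣≡∣p∣+∣q∣ : (p q : Subset n) → Disjoint p q → ∣ p ∪ q ∣ ≡ ∣ p ∣ + ∣ q ∣
∣p∪q∣≡∣p∣+∣q∣ []            []            _ = refl
∣p∪q∣≡∣p∣+∣q∣ (inside  ∷ p) (inside  ∷ q) d = contradiction (Fin.zero , here) d
∣p∪q∣≡∣p∣+∣q∣ (inside  ∷ p) (outside ∷ q) d = cong suc (∣p∪q∣≡∣p∣+∣q∣ p q (drop-∷-Empty d))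
∣p∪q∣≡∣p∣+∣q∣ (outside ∷ p) (inside  ∷ q) d =
  trans (cong suc (∣p∪q∣≡∣p∣+∣q∣ p q (drop-∷-Empty d))) (sym (+-suc ∣ p ∣ ∣ q ∣))
∣p∪q∣≡∣p∣+∣q∣ (outside ∷ p) (outside ∷ q) d = ∣p∪q∣≡∣p∣+∣q∣ p q (drop-∷-Empty d)

Disjoint-⋃ : {p : Subset n} (qs : List (Subset n)) → All (Disjoint p) qs → Disjoint p (⋃ qs)
Disjoint-⋃ {p = p} []       []            (x , x∈p∩⊥) = ∉⊥ (proj₂ (x∈p∩q⁻ p ⊥ x∈p∩⊥))
Disjoint-⋃ {p = p} (q ∷ qs) (p#q ∷ p#qs) (x , x∈p∩⋃) with x∈p∩q⁻ p _ x∈p∩⋃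
... | x∈p , x∈q∪⋃ with x∈p∪q⁻ q (⋃ qs) x∈q∪⋃
...   | inj₁ x∈q = p#q (x , x∈p∩q⁺ (x∈p , x∈q))
...   | inj₂ x∈⋃ = Disjoint-⋃ qs p#qs (x , x∈p∩q⁺ (x∈p , x∈⋃))

length*s≤∣⋃∣ : ∀ {s} (ps : List (Subset n)) → AllPairs Disjoint ps →
               All (λ p → s ≤ ∣ p ∣) ps → length ps * s ≤ ∣ ⋃ ps ∣
length*s≤∣⋃∣         []       []                []            = z≤n
length*s≤∣⋃∣ {s = s} (p ∷ ps) (p#ps ∷ disjoint) (s≤p ∷ large) = begin
  s + length ps * s  ≤⟨ +-mono-≤ s≤p (length*s≤∣⋃∣ ps disjoint large) ⟩
  ∣ p ∣ + ∣ ⋃ ps ∣   ≡⟨ sym (∣p∪q∣≡∣p∣+∣q∣ p (⋃ ps) (Disjoint-⋃ ps p#ps)) ⟩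
  ∣ p ∪ ⋃ ps ∣       ∎
  where open ≤-Reasoning

Nonempty⇒0<∣p∣ : {p : Subset n} → Nonempty p → 0 < ∣ p ∣
Nonempty⇒0<∣p∣ {p = p} (x , x∈p) =
  subst (_≤ ∣ p ∣) (∣⁅x⁆∣≡1 x) (p⊆q⇒∣p∣≤∣q∣ λ y∈⁅x⁆ → subst (_∈ p) (sym (x∈⁅y⁆⇒x≡y x y∈⁅x⁆)) x∈p)

length≡length-filter+length-filter∁ : ∀ {a p} {A : Set a} {P : Pred A p}
                                      (P? : Decidable P) (xs : List A) →
                                      length xs ≡ length (filter P? xs) + length (filter (∁? P?) xs)
length≡length-filter+length-filter∁ P? []       = refl
length≡length-filter+length-filter∁ P? (x ∷ xs) with P? x
... | yes _ = cong suc (length≡length-filter+length-filter∁ P? xs)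
... | no  _ = trans (cong suc (length≡length-filter+length-filter∁ P? xs)) (sym (+-suc _ _))

DisjointOrHalf : Subset n → Subset n → Set
DisjointOrHalf p q = Disjoint p q ⊎ 2 * ∣ q ∣ ≤ ∣ p ∣

sameBand⇒Disjoint : ∀ {h} {p q : Subset n} → ∣ p ∣ < 2 * h → h ≤ ∣ q ∣ →
                    DisjointOrHalf p q → Disjoint p q
sameBand⇒Disjoint _    _   (inj₁ p#q)  = p#q
sameBand⇒Disjoint p<2h h≤q (inj₂ 2q≤p) = contradiction (≤-trans (*-monoʳ-≤ 2 h≤q) 2q≤p) (<⇒≱ p<2h)

sameBand⇒pairwiseDisjoint : ∀ {h} {ps : List (Subset n)} →
                            All (λ p → h ≤ ∣ p ∣) ps → All (λ p → ∣ p ∣ < 2 * h) ps →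
                            AllPairs DisjointOrHalf ps → AllPairs Disjoint ps
sameBand⇒pairwiseDisjoint []          []            []           = []
sameBand⇒pairwiseDisjoint (_ ∷ large) (p<2h ∷ small) (p-rel ∷ rel) =
  All.zipWith (λ (h≤q , r) → sameBand⇒Disjoint p<2h h≤q r) (large , p-rel) ∷
  sameBand⇒pairwiseDisjoint large small rel

-- Induction on k, doubling h: the sets of size in [h, 2h) are pairwise disjoint, so there are
-- at most n/h of them, and by induction fewer than 2n/(2h) sets have size at least 2h.
halving-family-bound : ∀ k {h} → 0 < n → n < 2 ^ k * h → (ps : List (Subset n)) →
                       AllPairs DisjointOrHalf ps → All (λ p → h ≤ ∣ p ∣) ps →
                       length ps * h < 2 * n
halving-family-bound zero 0<n n<h [] _ _ = ≤-trans 0<n (m≤m+n _ _)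
halving-family-bound zero 0<n n<h (p ∷ _) _ (h≤p ∷ _) =
  contradiction (≤-trans h≤p (∣p∣≤n p)) (<⇒≱ (subst (_ <_) (*-identityˡ _) n<h))
halving-family-bound {n} (suc k) {h} 0<n n<2^[1+k]*h ps rel large = begin-strict
  length ps * h                      ≡⟨ cong (_* h) (length≡length-filter+length-filter∁ big? ps) ⟩
  (length big + length small) * h    ≡⟨ *-distribʳ-+ h (length big) (length small) ⟩
  length big * h + length small * h  <⟨ +-mono-<-≤ big-bound small-bound ⟩
  n + n                              ≡⟨ cong (n +_) (sym (+-identityʳ n)) ⟩
  2 * n                              ∎
  where
  open ≤-Reasoning
  big? : Decidable (λ p → 2 * h ≤ ∣ p ∣)
  big? p = 2 * h ≤? ∣ p ∣
  big small : List (Subset n)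
  big   = filter big? ps
  small = filter (∁? big?) ps

  big-bound : length big * h < n
  big-bound = *-cancelˡ-< 2 _ _ (begin-strict
    2 * (length big * h)   ≡⟨ x∙yz≈y∙xz 2 (length big) h ⟩
    length big * (2 * h)   <⟨ halving-family-bound k 0<n n<2^k*2h big
                                (AllPairs.filter⁺ big? rel) (All.all-filter big? ps) ⟩
    2 * n                  ∎)
    where
    n<2^k*2h : n < 2 ^ k * (2 * h)
    n<2^k*2h = subst (n <_) (trans (*-assoc 2 (2 ^ k) h) (x∙yz≈y∙xz 2 (2 ^ k) h)) n<2^[1+k]*h

  small-bound : length small * h ≤ n
  small-bound = ≤-trans (length*s≤∣⋃∣ small small-disjoint small-large) (∣p∣≤n (⋃ small))
    where
    small-large : All (λ p → h ≤ ∣ p ∣) small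
    small-large = All.filter⁺ (∁? big?) large
    small-disjoint : AllPairs Disjoint small
    small-disjoint = sameBand⇒pairwiseDisjoint small-large
      (All.map ≰⇒> (All.all-filter (∁? big?) ps)) (AllPairs.filter⁺ (∁? big?) rel)

n<2^suc⌊log₂n⌋ : ∀ n → n < 2 ^ suc ⌊log₂ n ⌋
n<2^suc⌊log₂n⌋ n = ≰⇒> λ 2^[1+⌊log₂n⌋]≤n →
  1+n≰n (subst (_≤ ⌊log₂ n ⌋) (⌊log₂[2^n]⌋≡n (suc ⌊log₂ n ⌋)) (⌊log₂⌋-mono-≤ 2^[1+⌊log₂n⌋]≤n))

-- With ℓ = ⌊log₂ n⌋ and b = 2 ^ (1 + ⌊log₂ ℓ⌋) we have t = 2b, n < 2 ^ (1 + ℓ) and 1 + ℓ ≤ b.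
iterations-bound : ∀ n h → suc (iterations n) * h < 2 * n → n ^ h ≤ 2 ^ n
iterations-bound n h [t+1]*h<2n = begin
  n ^ h            ≤⟨ ^-monoˡ-≤ h (<⇒≤ (n<2^suc⌊log₂n⌋ n)) ⟩
  (2 ^ suc ℓ) ^ h  ≡⟨ ^-*-assoc 2 (suc ℓ) h ⟩
  2 ^ (suc ℓ * h)  ≤⟨ ^-monoʳ-≤ 2 (*-monoˡ-≤ h (n<2^suc⌊log₂n⌋ ℓ)) ⟩
  2 ^ (b * h)      ≤⟨ ^-monoʳ-≤ 2 b*h≤n ⟩
  2 ^ n            ∎
  where
  open ≤-Reasoning
  ℓ b : ℕ
  ℓ = ⌊log₂ n ⌋
  b = 2 ^ suc ⌊log₂ ℓ ⌋
  b*h≤n : b * h ≤ n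
  b*h≤n = <⇒≤ (*-cancelˡ-< 2 _ _ (begin-strict
    2 * (b * h)             ≡⟨ sym (*-assoc 2 b h) ⟩
    2 * b * h               ≡⟨ cong (λ e → 2 ^ e * h) (+-comm 2 ⌊log₂ ℓ ⌋) ⟩
    iterations n * h        ≤⟨ m≤n+m _ h ⟩
    suc (iterations n) * h  <⟨ [t+1]*h<2n ⟩
    2 * n                   ∎))

module _ {n} {G : Graph n} where

  private
    variable
      U V K : Subset n
      x y z : Fin n

  walk-source : WalkIn G U x y → x ∈ U
  walk-source (here x∈U)     = x∈U
  walk-source (step x∈U _ _) = x∈U

  walk-target : WalkIn G U x y → y ∈ U
  walk-target (here y∈U)   = y∈U
  walk-target (step _ _ w) = walk-target w

  walk-snoc : WalkIn G U x y → Adj G y z → z ∈ U → WalkIn G U x z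
  walk-snoc (here x∈U)      yz z∈U = step x∈U yz (here z∈U)
  walk-snoc (step x∈U xw w) yz z∈U = step x∈U xw (walk-snoc w yz z∈U)

  walk-++ : WalkIn G U x y → WalkIn G U y z → WalkIn G U x z
  walk-++ (here _)        v = v
  walk-++ (step x∈U xw w) v = step x∈U xw (walk-++ w v)

  walk-reverse : WalkIn G U x y → WalkIn G U y x
  walk-reverse (here x∈U)      = here x∈U
  walk-reverse (step x∈U xw w) = walk-snoc (walk-reverse w) (Adj-sym G xw) x∈U

  walk-mono : U ⊆ V → WalkIn G U x y → WalkIn G V x y
  walk-mono U⊆V (here x∈U)      = here (U⊆V x∈U)
  walk-mono U⊆V (step x∈U xw w) = step (U⊆V x∈U) xw (walk-mono U⊆V w)

  Closed : Subset n → Subset n → Set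
  Closed U C = ∀ x y → x ∈ C → y ∈ U → Adj G x y → y ∈ C

  walk-restrict : ∀ {C} → Closed U C → x ∈ C → WalkIn G U x y → WalkIn G C x y
  walk-restrict closed x∈C (here _)      = here x∈C
  walk-restrict closed x∈C (step _ xw w) =
    step x∈C xw (walk-restrict closed (closed _ _ x∈C (walk-source w) xw) w)

  ConnectedSubset : Subset n → Subset n → Set
  ConnectedSubset U K = Nonempty K × K ⊆ U × ConnectedIn G K

  component⇒ConnectedSubset : ∀ {C} → IsComponent G U C → ConnectedSubset U C
  component⇒ConnectedSubset (nonempty , C⊆U , connected , _) = nonempty , C⊆U , connected

  ConnectedSubset-∁-anti : ∀ {S S'} → S ⊆ S' → ConnectedSubset (∁ S') K → ConnectedSubset (∁ S) K
  ConnectedSubset-∁-anti S⊆S' (nonempty , K⊆∁S' , connected) =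
    nonempty , p⊆q⇒∁p⊇∁q S⊆S' ∘ K⊆∁S' , connected

  reachable-component : (v : Fin n) → v ∈ U → (reach? : ∀ y → Dec (WalkIn G U v y)) →
                        Σ (Subset n) λ D → IsComponent G U D × (∀ {y} → WalkIn G U v y → y ∈ D)
  reachable-component {U} v v∈U reach? =
    D , ((v , reach⇒∈ (here v∈U)) , D⊆U , connected , closed) , reach⇒∈
    where
    D : Subset n
    D = tabulate (λ y → does (reach? y))

    reach⇒∈ : WalkIn G U v y → y ∈ D
    reach⇒∈ {y} w = lookup⇒[]= y D (trans (lookup∘tabulate _ y) (dec-true (reach? y) w))

    ∈⇒reach : y ∈ D → WalkIn G U v y
    ∈⇒reach {y} y∈D =
      invert (subst (Reflects _) (trans (sym (lookup∘tabulate _ y)) ([]=⇒lookup y∈D))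
                    (proof (reach? y)))

    D⊆U : D ⊆ U
    D⊆U = walk-target ∘ ∈⇒reach

    closed : Closed U D
    closed x y x∈D y∈U xy = reach⇒∈ (walk-snoc (∈⇒reach x∈D) xy y∈U)

    connected : ConnectedIn G D
    connected x y x∈D y∈D =
      walk-restrict closed x∈D (walk-++ (walk-reverse (∈⇒reach x∈D)) (∈⇒reach y∈D))

  component-containing : ConnectedSubset U K → ¬ ¬ (Σ (Subset n) λ D → IsComponent G U D × K ⊆ D)
  component-containing {U} {K} ((v , v∈K) , K⊆U , connected) =
    ¬¬-map extend (sequence rawApplicative (λ y → ¬¬-excluded-middle))
    where
    extend : (∀ y → Dec (WalkIn G U v y)) → Σ (Subset n) λ D → IsComponent G U D × K ⊆ D
    extend reach? with reachable-component v (K⊆U v∈K) reach?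
    ... | D , D-component , reach⇒∈ =
      D , D-component , λ y∈K → reach⇒∈ (walk-mono K⊆U (connected _ _ v∈K y∈K))

  max-component-bound : ∀ {C} → IsMaxComponent G U C → ConnectedSubset U K → ¬ ¬ (∣ K ∣ ≤ ∣ C ∣)
  max-component-bound (_ , maximal) K-connected =
    ¬¬-map (λ (D , D-component , K⊆D) → ≤-trans (p⊆q⇒∣p∣≤∣q∣ K⊆D) (maximal D D-component))
           (component-containing K-connected)

  -- A connected K meeting C lies in C, and if it also avoids x it lies in a component of C - x.
  centroid-split : ∀ {C} → IsComponent G U C → IsCentroid G C x → ConnectedSubset U K → x ∉ K →
                   ¬ ¬ DisjointOrHalf C K
  centroid-split {x = x} {K = K} {C = C}
                 (_ , _ , _ , C-closed) (_ , centroid) (K-nonempty , K⊆U , K-connected) x∉K =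
    ¬¬-excluded-middle >>= λ where
      (no C#K)          → pure (inj₁ C#K)
      (yes (w , w∈C∩K)) →
        ¬¬-map (λ (D , D-component , K⊆D) →
                  inj₂ (≤-trans (*-monoʳ-≤ 2 (p⊆q⇒∣p∣≤∣q∣ K⊆D)) (centroid D D-component)))
               (component-containing (K-nonempty , K⊆C-x w∈C∩K , K-connected))
    where
    K⊆C-x : ∀ {w} → w ∈ C ∩ K → K ⊆ C - x
    K⊆C-x w∈C∩K {y} y∈K with x∈p∩q⁻ C K w∈C∩K
    ... | w∈C , w∈K = x∈p∧x≢y⇒x∈p-y y∈C λ { refl → x∉K y∈K }
      where
      y∈C : y ∈ C
      y∈C = walk-target (walk-restrict C-closed w∈C (walk-mono K⊆U (K-connected _ _ w∈K y∈K)))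

  step-⊆ : ∀ {S S'} → Step G S S' → S ⊆ S'
  step-⊆ {S} (_ , x , _ , _ , ⁅x⁆∪S⊆S' , _) = ⁅x⁆∪S⊆S' ∘ q⊆p∪q ⁅ x ⁆ S

  process-⊆ : ∀ {k S R} → Process G k S R → S ⊆ R
  process-⊆ stop-full           = id
  process-⊆ stop-limit          = id
  process-⊆ (next advance rest) = process-⊆ rest ∘ step-⊆ advance

  -- The components chosen by the procedure from S on, followed by K.
  ChosenFamily : ℕ → Subset n → Subset n → Set
  ChosenFamily k S K = Σ (List (Subset n)) λ ps →
    length ps ≡ suc k × AllPairs DisjointOrHalf ps ×
    All (ConnectedSubset (∁ S)) ps × All (λ p → ∣ K ∣ ≤ ∣ p ∣) ps

  chosen-family : ∀ {k S R} → Process G k S R → ConnectedSubset (∁ R) K → ¬ ¬ ChosenFamily k S K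
  chosen-family stop-full ((v , v∈K) , K⊆∅ , _) = contradiction ∈⊤ (x∈∁p⇒x∉p (K⊆∅ v∈K))
  chosen-family stop-limit K-connected =
    pure (_ ∷ [] , refl , [] ∷ [] , K-connected ∷ [] , ≤-refl ∷ [])
  chosen-family (next {S = S} {S'} advance@(C , x , C-max , x-centroid , ⁅x⁆∪S⊆S' , _) rest)
                K-connected = do
    (ps , length≡ , ps-rel , ps-connected , ps-large) ← chosen-family rest K-connected
    C-rel ← All.mapM 0ℓ ¬¬-Monad
              (λ p-connected →
                 centroid-split (proj₁ C-max) x-centroid (∁-anti p-connected) (x∉ p-connected))
              ps-connected
    K≤C ← max-component-bound C-max
            (ConnectedSubset-∁-anti (process-⊆ (next advance rest)) K-connected)
    pure ( C ∷ ps , cong suc length≡ , C-rel ∷ ps-rel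
         , component⇒ConnectedSubset (proj₁ C-max) ∷ All.map ∁-anti ps-connected , K≤C ∷ ps-large)
    where
    ∁-anti : ∀ {p} → ConnectedSubset (∁ S') p → ConnectedSubset (∁ S) p
    ∁-anti = ConnectedSubset-∁-anti (step-⊆ advance)
    x∉ : ∀ {p} → ConnectedSubset (∁ S') p → x ∉ p
    x∉ (_ , p⊆∁S' , _) x∈p = x∈∁p⇒x∉p (p⊆∁S' x∈p) (⁅x⁆∪S⊆S' (p⊆p∪q S (x∈⁅x⁆ x)))

lemma4 : (n : ℕ) → 2 ≤ n → (T : Graph n) → IsTree T →
         (S : Subset n) → Process T (iterations n) ⊥ S →
         (H : Subset n) → IsComponent T (∁ S) H →
         n ^ ∣ H ∣ ≤ 2 ^ n
lemma4 n 2≤n T _ S process H H-component =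
  decidable-stable (n ^ ∣ H ∣ ≤? 2 ^ n) (¬¬-map bound (chosen-family process H-connected))
  where
  H-connected : ConnectedSubset (∁ S) H
  H-connected = component⇒ConnectedSubset H-component

  n<2^[1+⌊log₂n⌋]*∣H∣ : n < 2 ^ suc ⌊log₂ n ⌋ * ∣ H ∣
  n<2^[1+⌊log₂n⌋]*∣H∣ =
    <-≤-trans (n<2^suc⌊log₂n⌋ n) (m≤m*n _ ∣ H ∣ {{>-nonZero (Nonempty⇒0<∣p∣ (proj₁ H-connected))}})

  bound : ChosenFamily (iterations n) ⊥ H → n ^ ∣ H ∣ ≤ 2 ^ n
  bound (ps , length≡ , ps-rel , _ , ps-large) =
    iterations-bound n ∣ H ∣ (subst (λ l → l * ∣ H ∣ < 2 * n) length≡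
      (halving-family-bound (suc ⌊log₂ n ⌋) (≤-trans (s≤s z≤n) 2≤n) n<2^[1+⌊log₂n⌋]*∣H∣
                            ps ps-rel ps-large))
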